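{- Let $(G,s,t)$ be a weak link containing a short-cut $\{a,b\}$, where $b$ has degree 2, is adjacent to one terminal and at distance 2 from the other, and $a$ has degree greater than 2. Then $a$ is a pivot of the link.
   Context: A Shannon game (link) $(G,s,t)$ consists of a finite simple graph $G$ and two distinct designated vertices $s,t$, the terminals. Two players, Short and Cut, alternately select a not-yet-selected non-terminal vertex; Short claims ("shorts") his vertices, Cut deletes his. Shorting $v$ is equivalent to deleting $v$ and making all pairs of former neighbours of $v$ adjacent. Short wins if at the end there is an $s$–$t$ path all of whose internal vertices are claimed by Short; otherwise Cut wins. The link is strong if Short has a winning strategy when moving second, and weak if Short has a winning strategy when moving first but not when moving second. A pivot of a weak link is a non-terminal vertex which, if shorted, turns the link into a strong link. A short-cut is a pair of adjacent non-terminal vertices, one of which has degree 2, is adjacent to one terminal and is at distance 2 from the other terminal. -}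

module Defs where

open import Data.Nat using (ℕ; zero; suc; _+_; _>_)
open import Data.Bool using (Bool; true; false; if_then_else_)
open import Data.Fin using (Fin; _≟_)
open import Data.List using (List; map)
open import Data.Nat.ListAction using (sum)
open import Data.List.Base using ()
open import Data.Fin.Base using ()
open import Data.Product using (_×_; ∃; ∃-syntax; _,_)
open import Data.Sum using (_⊎_)
open import Relation.Nullary using (¬_; does)
open import Relation.Binary.PropositionalEquality using (_≡_; _≢_)
import Data.List as L
import Data.Fin as F

record SimpleGraph (n : ℕ) : Set where
  field
    adj   : Fin n → Fin n → Bool
    sym   : ∀ u v → adj u v ≡ adj v u
    loopless : ∀ v → adj v v ≡ false

open SimpleGraph public

module _ {n : ℕ} (G : SimpleGraph n) where

  Adj : Fin n → Fin n → Set
  Adj u v = adj G u v ≡ true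

  degree : Fin n → ℕ
  degree v = sum (map (λ u → if adj G v u then 1 else 0) (L.allFin n))

  Dist2 : Fin n → Fin n → Set
  Dist2 u v = u ≢ v × ¬ Adj u v × ∃[ w ] (Adj u w × Adj w v)

data Mark : Set where
  free shorted cut : Mark

State : ℕ → Set
State n = Fin n → Mark

initial : ∀ {n} → State n
initial _ = free

update : ∀ {n} → State n → Fin n → Mark → State n
update σ v m u = if does (u ≟ v) then m else σ u

module Game {n : ℕ} (G : SimpleGraph n) (s t : Fin n) where

  Free : State n → Fin n → Set
  Free σ v = v ≢ s × v ≢ t × σ v ≡ free

  AllSelected : State n → Set
  AllSelected σ = ∀ v → v ≢ s → v ≢ t → σ v ≢ free

  data ShortWalk (σ : State n) (u : Fin n) : Fin n → Set where
    edge : ∀ {v} → Adj G u v → ShortWalk σ u v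
    step : ∀ {w v} → ShortWalk σ u w → σ w ≡ shorted → Adj G w v → ShortWalk σ u v

  ShortWon : State n → Set
  ShortWon σ = ShortWalk σ s t

  mutual
    data ShortWinsShortToMove (σ : State n) : Set where
      sdone : AllSelected σ → ShortWon σ → ShortWinsShortToMove σ
      smove : ∀ v → Free σ v → ShortWinsCutToMove (update σ v shorted)
            → ShortWinsShortToMove σ

    data ShortWinsCutToMove (σ : State n) : Set where
      cmove : (AllSelected σ → ShortWon σ)
            → (∀ v → Free σ v → ShortWinsShortToMove (update σ v cut))
            → ShortWinsCutToMove σ

  StrongLink : Set
  StrongLink = ShortWinsCutToMove initial

  WeakLink : Set
  WeakLink = ShortWinsShortToMove initial × ¬ ShortWinsCutToMove initial

  Pivot : Fin n → Set
  Pivot a = a ≢ s × a ≢ t × ShortWinsCutToMove (update initial a shorted)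

  ShortCut : Fin n → Fin n → Set
  ShortCut a b =
    a ≢ s × a ≢ t × b ≢ s × b ≢ t × Adj G a b × degree G b ≡ 2 ×
    ((Adj G b s × Dist2 G b t) ⊎ (Adj G b t × Dist2 G b s))

-- Short opens by shorting a.  If Cut does not answer at b, Short shorts b and
-- has already won: b lies next to one terminal, and the vertex through which b
-- reaches the other terminal is a (or the terminals are adjacent).  If Cut
-- cuts b, Short plays his first-player winning strategy in an imagined game in
-- which {a, b} is a pair: whenever the strategy takes one of a, b, Short
-- pretends Cut took the other.  Every imagined win is a real win.  When the
-- strategy has shorted a the imagined and real positions agree; when it has
-- shorted b and a is cut, every neighbour of b is cut or a terminal, so b could
-- only lie on a path s–b–t, which the distance-2 condition excludes.
module Submission where

open import Defs
open import Data.Nat using (ℕ; _>_)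
open import Data.Fin using (Fin)
open import Relation.Binary.PropositionalEquality using (_≢_)

open import Data.Nat using (_≤_; _<_; z≤n; s≤s)
open import Data.Nat.Properties using (≤-refl; ≤-trans; +-mono-≤; +-mono-<-≤; +-mono-≤-<; n≮n)
open import Data.Nat.Induction using (<-wellFounded)
open import Data.Nat.ListAction using (sum)
open import Data.Bool using (if_then_else_)
open import Data.Fin using (_≟_)
open import Data.Fin.Properties using (any?)
open import Data.List using (List; []; _∷_; map; allFin)
open import Data.List.Membership.Propositional using (_∈_)
open import Data.List.Membership.Propositional.Properties using (∈-allFin)
open import Data.List.Relation.Unary.Any using (here; there)
open import Data.Product using (_×_; _,_; proj₁; proj₂)
open import Data.Sum using (_⊎_; inj₁; inj₂; map₂)
open import Data.Empty using (⊥-elim)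
open import Function using (_∘_)
open import Induction.WellFounded using (Acc; acc)
open import Relation.Nullary using (¬_; Dec; yes; no; does; ¬?)
open import Relation.Nullary.Decidable using (_×-dec_)
open import Relation.Binary.PropositionalEquality using (_≡_; refl; trans; subst; ≢-sym)
import Relation.Binary.PropositionalEquality as ≡

sum-map-mono-≤ : ∀ {A : Set} {f g : A → ℕ} (xs : List A) → (∀ x → f x ≤ g x) →
                 sum (map f xs) ≤ sum (map g xs)
sum-map-mono-≤ []       f≤g = z≤n
sum-map-mono-≤ (x ∷ xs) f≤g = +-mono-≤ (f≤g x) (sum-map-mono-≤ xs f≤g)

sum-map-mono-< : ∀ {A : Set} {f g : A → ℕ} {xs : List A} {x : A} → (∀ y → f y ≤ g y) →
                 x ∈ xs → f x < g x → sum (map f xs) < sum (map g xs)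
sum-map-mono-< {xs = _ ∷ xs} f≤g (here refl)  fx<gx = +-mono-<-≤ fx<gx (sum-map-mono-≤ xs f≤g)
sum-map-mono-< {xs = y ∷ _}  f≤g (there x∈xs) fx<gx = +-mono-≤-< (f≤g y) (sum-map-mono-< f≤g x∈xs fx<gx)

different-marks : ∀ {x m m′ : Mark} → m ≢ m′ → x ≡ m → x ≢ m′
different-marks m≢m′ refl = m≢m′

update-≡ : ∀ {n} (σ : State n) v m → update σ v m v ≡ m
update-≡ σ v m with v ≟ v
... | yes _   = refl
... | no v≢v = ⊥-elim (v≢v refl)

update-≢ : ∀ {n} (σ : State n) {v u} m → u ≢ v → update σ v m u ≡ σ u
update-≢ σ {v} {u} m u≢v with u ≟ v
... | yes u≡v = ⊥-elim (u≢v u≡v)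
... | no _    = refl

update-update-≢ : ∀ {n} (σ : State n) {x y u} {m m′} → u ≢ x → u ≢ y →
                  update (update σ x m) y m′ u ≡ σ u
update-update-≢ σ {x} {m = m} {m′} u≢x u≢y = trans (update-≢ (update σ x m) m′ u≢y) (update-≢ σ m u≢x)

-- Degrees

erase : ∀ {n} → Fin n → (Fin n → ℕ) → Fin n → ℕ
erase x f u = if does (u ≟ x) then 0 else f u

erase-≤ : ∀ {n} x (f : Fin n → ℕ) u → erase x f u ≤ f u
erase-≤ x f u with u ≟ x
... | yes _ = z≤n
... | no _  = ≤-refl

erase-positive : ∀ {n} {x u} (f : Fin n → ℕ) → u ≢ x → 0 < f u → 0 < erase x f u
erase-positive {x = x} {u} f u≢x 0<fu with u ≟ x
... | yes u≡x = ⊥-elim (u≢x u≡x)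
... | no _    = 0<fu

sum-erase< : ∀ {n} x (f : Fin n → ℕ) → 0 < f x →
             sum (map (erase x f) (allFin n)) < sum (map f (allFin n))
sum-erase< x f 0<fx = sum-map-mono-< {f = erase x f} {g = f} (erase-≤ x f) (∈-allFin x) erased
  where
  erased : erase x f x < f x
  erased with x ≟ x
  ... | yes _   = 0<fx
  ... | no x≢x = ⊥-elim (x≢x refl)

module _ {n : ℕ} (G : SimpleGraph n) where

  Adj-sym : ∀ {u v} → Adj G u v → Adj G v u
  Adj-sym {u} {v} uv = trans (sym G v u) uv

  Adj-irrefl : ∀ {u v} → Adj G u v → u ≢ v
  Adj-irrefl {u} uu refl with trans (≡.sym (loopless G u)) uu
  ... | ()

  three-neighbours⇒3≤degree : ∀ {v x y z} → Adj G v x → Adj G v y → Adj G v z →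
                              x ≢ y → x ≢ z → y ≢ z → 3 ≤ degree G v
  three-neighbours⇒3≤degree {v} {x} {y} {z} vx vy vz x≢y x≢z y≢z =
    ≤-trans (s≤s (≤-trans (s≤s (≤-trans (s≤s z≤n) f₃<f₂)) f₂<f₁)) f₁<degree
    where
    total : (Fin n → ℕ) → ℕ
    total f = sum (map f (allFin n))

    neighbour : Fin n → ℕ
    neighbour u = if adj G v u then 1 else 0

    neighbour-positive : ∀ {u} → Adj G v u → 0 < neighbour u
    neighbour-positive vu rewrite vu = s≤s z≤n

    f₁ f₂ f₃ : Fin n → ℕ
    f₁ = erase x neighbour
    f₂ = erase y f₁
    f₃ = erase z f₂

    f₁<degree : total f₁ < degree G v
    f₁<degree = sum-erase< x neighbour (neighbour-positive vx)

    f₂<f₁ : total f₂ < total f₁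
    f₂<f₁ = sum-erase< y f₁ (erase-positive neighbour (≢-sym x≢y) (neighbour-positive vy))

    f₃<f₂ : total f₃ < total f₂
    f₃<f₂ = sum-erase< z f₂
      (erase-positive f₁ (≢-sym y≢z) (erase-positive neighbour (≢-sym x≢z) (neighbour-positive vz)))

  degree≡2-neighbours : ∀ {v x y} → degree G v ≡ 2 → Adj G v x → Adj G v y → x ≢ y →
                        ∀ {u} → Adj G v u → u ≡ x ⊎ u ≡ y
  degree≡2-neighbours {x = x} {y} deg vx vy x≢y {u} vu with u ≟ x | u ≟ y
  ... | yes u≡x | _       = inj₁ u≡x
  ... | no _    | yes u≡y = inj₂ u≡y
  ... | no u≢x  | no u≢y  = ⊥-elim (n≮n 2 (subst (3 ≤_) deg
        (three-neighbours⇒3≤degree vx vy vu x≢y (≢-sym u≢x) (≢-sym u≢y))))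

-- Shannon games

freeIndicator : Mark → ℕ
freeIndicator free    = 1
freeIndicator shorted = 0
freeIndicator cut     = 0

freeCount : ∀ {n} → State n → ℕ
freeCount {n} σ = sum (map (freeIndicator ∘ σ) (allFin n))

freeIndicator≤1 : ∀ m → freeIndicator m ≤ 1
freeIndicator≤1 free    = ≤-refl
freeIndicator≤1 shorted = z≤n
freeIndicator≤1 cut     = z≤n

freeIndicator<1 : ∀ {m} → m ≢ free → freeIndicator m < 1
freeIndicator<1 {free}    m≢free = ⊥-elim (m≢free refl)
freeIndicator<1 {shorted} _      = s≤s z≤n
freeIndicator<1 {cut}     _      = s≤s z≤n

freeCount-update< : ∀ {n} (σ : State n) {v} m → σ v ≡ free → m ≢ free →
                    freeCount (update σ v m) < freeCount σ
freeCount-update< σ {v} m σv≡free m≢free = sum-map-mono-< unchanged (∈-allFin v) decreased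
  where
  unchanged : ∀ u → freeIndicator (update σ v m u) ≤ freeIndicator (σ u)
  unchanged u with u ≟ v
  ... | yes refl rewrite σv≡free = freeIndicator≤1 m
  ... | no _     = ≤-refl

  decreased : freeIndicator (update σ v m v) < freeIndicator (σ v)
  decreased rewrite update-≡ σ v m | σv≡free = freeIndicator<1 m≢free

module _ {n : ℕ} (G : SimpleGraph n) (s t : Fin n) where
  open Game G s t

  free? : ∀ m → Dec (m ≡ free)
  free? free    = yes refl
  free? shorted = no λ ()
  free? cut     = no λ ()

  Free? : ∀ σ v → Dec (Free σ v)
  Free? σ v = ¬? (v ≟ s) ×-dec ¬? (v ≟ t) ×-dec free? (σ v)

  ShortWalk-mono : ∀ {σ τ u v} → (∀ w → σ w ≡ shorted → τ w ≡ shorted) →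
                   ShortWalk σ u v → ShortWalk τ u v
  ShortWalk-mono σ⊆τ (edge uv)         = edge uv
  ShortWalk-mono σ⊆τ (step walk σw wv) = step (ShortWalk-mono σ⊆τ walk) (σ⊆τ _ σw) wv

  enters-from-start : ∀ {σ b u} → (∀ {w} → Adj G b w → σ w ≢ shorted) →
                      ShortWalk σ u b → Adj G u b
  enters-from-start unshorted (edge ub)     = ub
  enters-from-start unshorted (step _ σw wb) = ⊥-elim (unshorted (Adj-sym G wb) σw)

  -- A vertex whose neighbours are all unshorted can only be used as the single
  -- internal vertex of a walk.
  ShortWalk-bypass : ∀ {σ τ b} → (∀ {w} → Adj G b w → σ w ≢ shorted) →
                     (∀ w → σ w ≡ shorted → w ≢ b → τ w ≡ shorted) →
                     ∀ {u v} → ShortWalk σ u v → ShortWalk τ u v ⊎ (Adj G u b × Adj G b v)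
  ShortWalk-bypass unshorted lift (edge uv) = inj₁ (edge uv)
  ShortWalk-bypass {b = b} unshorted lift (step {w} walk σw wv) with w ≟ b
  ... | yes refl = inj₂ (enters-from-start unshorted walk , wv)
  ... | no w≢b with ShortWalk-bypass unshorted lift walk
  ...   | inj₁ walk′    = inj₁ (step walk′ (lift w σw w≢b) wv)
  ...   | inj₂ (_ , bw) = ⊥-elim (unshorted bw σw)

  update-keeps-ShortWon : ∀ {σ v} m → σ v ≡ free → ShortWon σ → ShortWon (update σ v m)
  update-keeps-ShortWon {σ} {v} m σv≡free = ShortWalk-mono kept
    where
    kept : ∀ w → σ w ≡ shorted → update σ v m w ≡ shorted
    kept w σw with w ≟ v
    ... | yes refl = ⊥-elim (different-marks (λ ()) σv≡free σw)
    ... | no w≢v   = σw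

  mutual
    won⇒winsShortToMove : ∀ {σ} → Acc _<_ (freeCount σ) → ShortWon σ → ShortWinsShortToMove σ
    won⇒winsShortToMove {σ} (acc rec) won with any? (Free? σ)
    ... | no none = sdone (λ v v≢s v≢t σv≡free → none (v , v≢s , v≢t , σv≡free)) won
    ... | yes (v , fv@(_ , _ , σv≡free)) =
      smove v fv (won⇒winsCutToMove (rec (freeCount-update< σ shorted σv≡free λ ()))
                                     (update-keeps-ShortWon shorted σv≡free won))

    won⇒winsCutToMove : ∀ {σ} → Acc _<_ (freeCount σ) → ShortWon σ → ShortWinsCutToMove σ
    won⇒winsCutToMove {σ} (acc rec) won = cmove (λ _ → won) λ where
      v (_ , _ , σv≡free) → won⇒winsShortToMove (rec (freeCount-update< σ cut σv≡free λ ()))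
                                                 (update-keeps-ShortWon cut σv≡free won)

  shortWon⇒shortWinsCutToMove : ∀ {σ} → ShortWon σ → ShortWinsCutToMove σ
  shortWon⇒shortWinsCutToMove = won⇒winsCutToMove (<-wellFounded _)

  lastMove-shortWon : ∀ {σ a} → Free σ a → (∀ v → Free σ v → v ≡ a) →
                      ShortWinsShortToMove σ → ShortWon (update σ a shorted)
  lastMove-shortWon (a≢s , a≢t , σa≡free) _ (sdone allSelected _) =
    ⊥-elim (allSelected _ a≢s a≢t σa≡free)
  lastMove-shortWon {σ} _ onlyFree (smove v fv (cmove final _)) with onlyFree v fv
  ... | refl = final allSelected
    where
    allSelected : AllSelected (update σ v shorted)
    allSelected u u≢s u≢t fu = u≢v (onlyFree u (u≢s , u≢t , trans (≡.sym (update-≢ σ shorted u≢v)) fu))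
      where
      u≢v : u ≢ v
      u≢v refl = different-marks (λ ()) (update-≡ σ u shorted) fu

-- Playing a first-player strategy with a shorted and b cut

module PairStrategy {n : ℕ} (G : SimpleGraph n) (s t a b : Fin n)
  (a≢s : a ≢ s) (a≢t : a ≢ t) (b≢s : b ≢ s) (b≢t : b ≢ t) (a≢b : a ≢ b)
  (b-neighbours : ∀ {u} → Adj G b u → u ≡ a ⊎ u ≡ s ⊎ u ≡ t)
  (no-bridge : ¬ (Adj G s b × Adj G b t)) where

  open Game G s t

  data Pairing (ι : State n) : Set where
    unplayed  : ι a ≡ free    → ι b ≡ free    → Pairing ι
    a-shorted : ι a ≡ shorted → ι b ≡ cut     → Pairing ι
    b-shorted : ι a ≡ cut     → ι b ≡ shorted → Pairing ι

  Pairing-resp : ∀ {ι ι′} → ι′ a ≡ ι a → ι′ b ≡ ι b → Pairing ι → Pairing ι′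
  Pairing-resp a≡ b≡ (unplayed  ιa ιb) = unplayed  (trans a≡ ιa) (trans b≡ ιb)
  Pairing-resp a≡ b≡ (a-shorted ιa ιb) = a-shorted (trans a≡ ιa) (trans b≡ ιb)
  Pairing-resp a≡ b≡ (b-shorted ιa ιb) = b-shorted (trans a≡ ιa) (trans b≡ ιb)

  -- ι is the imagined position of Short's strategy, ρ the real one.
  record Imitates (ι ρ : State n) : Set where
    field
      agree   : ∀ {v} → v ≢ a → v ≢ b → ι v ≡ ρ v
      real-a  : ρ a ≡ shorted
      real-b  : ρ b ≡ cut
      s-free  : ι s ≡ free
      t-free  : ι t ≡ free
      pairing : Pairing ι

  open Imitates

  imitates-initial : Imitates initial (update (update initial a shorted) b cut)
  imitates-initial = record
    { agree   = λ v≢a v≢b → ≡.sym (update-update-≢ initial v≢a v≢b)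
    ; real-a  = trans (update-≢ (update initial a shorted) cut a≢b) (update-≡ initial a shorted)
    ; real-b  = update-≡ (update initial a shorted) b cut
    ; s-free  = refl
    ; t-free  = refl
    ; pairing = unplayed refl refl
    }

  reimagine : ∀ {ι ι′ ρ} → Imitates ι ρ → (∀ {v} → v ≢ a → v ≢ b → ι′ v ≡ ι v) →
              Pairing ι′ → Imitates ι′ ρ
  reimagine r same p = record
    { agree   = λ v≢a v≢b → trans (same v≢a v≢b) (agree r v≢a v≢b)
    ; real-a  = real-a r
    ; real-b  = real-b r
    ; s-free  = trans (same (≢-sym a≢s) (≢-sym b≢s)) (s-free r)
    ; t-free  = trans (same (≢-sym a≢t) (≢-sym b≢t)) (t-free r)
    ; pairing = p
    }

  imagine-a-shorted-b-cut : ∀ {ι ρ} → Imitates ι ρ → Imitates (update (update ι a shorted) b cut) ρ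
  imagine-a-shorted-b-cut {ι} r = reimagine r (update-update-≢ ι)
    (a-shorted (trans (update-≢ (update ι a shorted) cut a≢b) (update-≡ ι a shorted))
               (update-≡ (update ι a shorted) b cut))

  imagine-b-cut-a-shorted : ∀ {ι ρ} → Imitates ι ρ → Imitates (update (update ι b cut) a shorted) ρ
  imagine-b-cut-a-shorted {ι} r = reimagine r (λ v≢a v≢b → update-update-≢ ι v≢b v≢a)
    (a-shorted (update-≡ (update ι b cut) a shorted)
               (trans (update-≢ (update ι b cut) shorted (≢-sym a≢b)) (update-≡ ι b cut)))

  imagine-b-shorted-a-cut : ∀ {ι ρ} → Imitates ι ρ → Imitates (update (update ι b shorted) a cut) ρ
  imagine-b-shorted-a-cut {ι} r = reimagine r (λ v≢a v≢b → update-update-≢ ι v≢b v≢a)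
    (b-shorted (update-≡ (update ι b shorted) a cut)
               (trans (update-≢ (update ι b shorted) cut (≢-sym a≢b)) (update-≡ ι b shorted)))

  partner-of-a-free : ∀ {ι} → Pairing ι → ι a ≡ free → ι b ≡ free
  partner-of-a-free (unplayed _ ιb)  _  = ιb
  partner-of-a-free (a-shorted ιa _) ιa′ = ⊥-elim (different-marks (λ ()) ιa ιa′)
  partner-of-a-free (b-shorted ιa _) ιa′ = ⊥-elim (different-marks (λ ()) ιa ιa′)

  partner-of-b-free : ∀ {ι} → Pairing ι → ι b ≡ free → ι a ≡ free
  partner-of-b-free (unplayed ιa _)  _  = ιa
  partner-of-b-free (a-shorted _ ιb) ιb′ = ⊥-elim (different-marks (λ ()) ιb ιb′)
  partner-of-b-free (b-shorted _ ιb) ιb′ = ⊥-elim (different-marks (λ ()) ιb ιb′)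

  outside-pair : ∀ {ι ρ v} → Imitates ι ρ → ρ v ≡ free → v ≢ a × v ≢ b
  outside-pair r ρv≡free = (λ { refl → different-marks (λ ()) (real-a r) ρv≡free })
                         , (λ { refl → different-marks (λ ()) (real-b r) ρv≡free })

  imagined-free : ∀ {ι ρ v} → Imitates ι ρ → Free ρ v → Free ι v
  imagined-free r (v≢s , v≢t , ρv≡free) with outside-pair r ρv≡free
  ... | v≢a , v≢b = v≢s , v≢t , trans (agree r v≢a v≢b) ρv≡free

  real-free : ∀ {ι ρ v} → Imitates ι ρ → v ≢ a → v ≢ b → Free ι v → Free ρ v
  real-free r v≢a v≢b (v≢s , v≢t , ιv≡free) = v≢s , v≢t , trans (≡.sym (agree r v≢a v≢b)) ιv≡free

  imitate-move : ∀ {ι ρ v} m → Imitates ι ρ → Free ρ v → Imitates (update ι v m) (update ρ v m)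
  imitate-move {ι} {ρ} {v} m r (v≢s , v≢t , ρv≡free) = record
    { agree   = agree′
    ; real-a  = trans (update-≢ ρ m (≢-sym v≢a)) (real-a r)
    ; real-b  = trans (update-≢ ρ m (≢-sym v≢b)) (real-b r)
    ; s-free  = trans (update-≢ ι m (≢-sym v≢s)) (s-free r)
    ; t-free  = trans (update-≢ ι m (≢-sym v≢t)) (t-free r)
    ; pairing = Pairing-resp (update-≢ ι m (≢-sym v≢a)) (update-≢ ι m (≢-sym v≢b)) (pairing r)
    }
    where
    v≢a : v ≢ a
    v≢a = proj₁ (outside-pair r ρv≡free)
    v≢b : v ≢ b
    v≢b = proj₂ (outside-pair r ρv≡free)

    agree′ : ∀ {u} → u ≢ a → u ≢ b → update ι v m u ≡ update ρ v m u
    agree′ {u} u≢a u≢b with u ≟ v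
    ... | yes _ = refl
    ... | no _  = agree r u≢a u≢b

  shorted-transfer : ∀ {ι ρ} → Imitates ι ρ → ∀ w → ι w ≡ shorted → w ≢ b → ρ w ≡ shorted
  shorted-transfer r w ιw w≢b with w ≟ a
  ... | yes refl = real-a r
  ... | no w≢a   = trans (≡.sym (agree r w≢a w≢b)) ιw

  shorted-transfer-b-unshorted : ∀ {ι ρ} → Imitates ι ρ → ι b ≢ shorted →
                                 ∀ w → ι w ≡ shorted → ρ w ≡ shorted
  shorted-transfer-b-unshorted r ιb≢shorted w ιw = shorted-transfer r w ιw λ { refl → ιb≢shorted ιw }

  b-neighbours-unshorted : ∀ {ι ρ} → Imitates ι ρ → ι a ≡ cut → ∀ {u} → Adj G b u → ι u ≢ shorted
  b-neighbours-unshorted r ιa bu with b-neighbours bu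
  ... | inj₁ refl        = different-marks (λ ()) ιa
  ... | inj₂ (inj₁ refl) = different-marks (λ ()) (s-free r)
  ... | inj₂ (inj₂ refl) = different-marks (λ ()) (t-free r)

  won-transfer : ∀ {ι ρ} → Imitates ι ρ → ShortWon ι → ShortWon ρ
  won-transfer r won with pairing r
  ... | unplayed  _ ιb =
    ShortWalk-mono G s t (shorted-transfer-b-unshorted r (different-marks (λ ()) ιb)) won
  ... | a-shorted _ ιb =
    ShortWalk-mono G s t (shorted-transfer-b-unshorted r (different-marks (λ ()) ιb)) won
  ... | b-shorted ιa _ with ShortWalk-bypass G s t (b-neighbours-unshorted r ιa) (shorted-transfer r) won
  ...   | inj₁ walk   = walk
  ...   | inj₂ bridge = ⊥-elim (no-bridge bridge)

  allSelected-transfer : ∀ {ι ρ} → Imitates ι ρ → AllSelected ι → AllSelected ρ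
  allSelected-transfer r allSelected v v≢s v≢t ρv≡free =
    allSelected v v≢s v≢t (proj₂ (proj₂ (imagined-free r (v≢s , v≢t , ρv≡free))))

  allSelected-back : ∀ {ι ρ} → Imitates ι ρ → ι a ≢ free → ι b ≢ free →
                     AllSelected ρ → AllSelected ι
  allSelected-back r ιa≢free ιb≢free allSelected v v≢s v≢t ιv≡free =
    allSelected v v≢s v≢t (proj₂ (proj₂ (real-free r v≢a v≢b (v≢s , v≢t , ιv≡free))))
    where
    v≢a : _ ≢ a
    v≢a refl = ιa≢free ιv≡free
    v≢b : _ ≢ b
    v≢b refl = ιb≢free ιv≡free

  -- If the real game is over while a and b are unplayed in the imagined one,
  -- Cut imagines cutting b; Short's strategy must then short a, the last free
  -- vertex, and win.
  final-transfer : ∀ {ι ρ} → Imitates ι ρ → (AllSelected ι → ShortWon ι) →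
                   (∀ v → Free ι v → ShortWinsShortToMove (update ι v cut)) →
                   AllSelected ρ → ShortWon ρ
  final-transfer {ι} r final replies allSelected with pairing r
  ... | unplayed ιa ιb = won-transfer (imagine-b-cut-a-shorted r)
        (lastMove-shortWon G s t (a≢s , a≢t , trans (update-≢ ι cut a≢b) ιa) only-a
                           (replies b (b≢s , b≢t , ιb)))
    where
    only-a : ∀ v → Free (update ι b cut) v → v ≡ a
    only-a v (v≢s , v≢t , fv) with v ≟ a
    ... | yes v≡a = v≡a
    ... | no v≢a  = ⊥-elim (allSelected v v≢s v≢t (proj₂ (proj₂
          (real-free r v≢a v≢b (v≢s , v≢t , trans (≡.sym (update-≢ ι cut v≢b)) fv)))))
      where
      v≢b : v ≢ b
      v≢b refl = different-marks (λ ()) (update-≡ ι v cut) fv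
  ... | a-shorted ιa ιb = won-transfer r (final (allSelected-back r
          (different-marks (λ ()) ιa) (different-marks (λ ()) ιb) allSelected))
  ... | b-shorted ιa ιb = won-transfer r (final (allSelected-back r
          (different-marks (λ ()) ιa) (different-marks (λ ()) ιb) allSelected))

  mutual
    imitateS : ∀ {ι ρ} → Imitates ι ρ → ShortWinsShortToMove ι → ShortWinsShortToMove ρ
    imitateS r (sdone allSelected won) = sdone (allSelected-transfer r allSelected) (won-transfer r won)
    imitateS {ι} r (smove v fv next) with v ≟ a | v ≟ b | next
    ... | yes refl | _ | cmove _ replies =
      imitateS (imagine-a-shorted-b-cut r)
        (replies b (b≢s , b≢t , trans (update-≢ ι shorted (≢-sym a≢b))
                                      (partner-of-a-free (pairing r) (proj₂ (proj₂ fv)))))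
    ... | no _ | yes refl | cmove _ replies =
      imitateS (imagine-b-shorted-a-cut r)
        (replies a (a≢s , a≢t , trans (update-≢ ι shorted a≢b)
                                      (partner-of-b-free (pairing r) (proj₂ (proj₂ fv)))))
    ... | no v≢a | no v≢b | _ =
      smove v (real-free r v≢a v≢b fv) (imitateC (imitate-move shorted r (real-free r v≢a v≢b fv)) next)

    imitateC : ∀ {ι ρ} → Imitates ι ρ → ShortWinsCutToMove ι → ShortWinsCutToMove ρ
    imitateC r (cmove final replies) = cmove (final-transfer r final replies) λ v fv →
      imitateS (imitate-move cut r fv) (replies v (imagined-free r fv))

-- Short-cuts

module _ {n : ℕ} (G : SimpleGraph n) (s t : Fin n) {a b : Fin n} where
  open Game G s t

  shortCut-neighbours : ShortCut a b → ∀ {u} → Adj G b u → u ≡ a ⊎ u ≡ s ⊎ u ≡ t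
  shortCut-neighbours (a≢s , _ , _ , _ , ab , deg , inj₁ (bs , _)) bu =
    map₂ inj₁ (degree≡2-neighbours G deg (Adj-sym G ab) bs a≢s bu)
  shortCut-neighbours (_ , a≢t , _ , _ , ab , deg , inj₂ (bt , _)) bu =
    map₂ inj₂ (degree≡2-neighbours G deg (Adj-sym G ab) bt a≢t bu)

  shortCut-not-bridge : ShortCut a b → ¬ (Adj G s b × Adj G b t)
  shortCut-not-bridge (_ , _ , _ , _ , _ , _ , inj₁ (_ , _ , b≁t , _)) (_ , bt) = b≁t bt
  shortCut-not-bridge (_ , _ , _ , _ , _ , _ , inj₂ (_ , _ , b≁s , _)) (sb , _) = b≁s (Adj-sym G sb)

  shortCut-shortWon : ShortCut a b → ∀ σ → σ a ≡ shorted → σ b ≡ shorted → ShortWon σ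
  shortCut-shortWon sc@(_ , _ , _ , _ , ab , _ , inj₁ (bs , _ , _ , w , bw , wt)) σ σa σb
    with shortCut-neighbours sc bw
  ... | inj₁ refl        = step (step (edge (Adj-sym G bs)) σb (Adj-sym G ab)) σa wt
  ... | inj₂ (inj₁ refl) = edge wt
  ... | inj₂ (inj₂ refl) = ⊥-elim (Adj-irrefl G wt refl)
  shortCut-shortWon sc@(_ , _ , _ , _ , ab , _ , inj₂ (bt , _ , _ , w , bw , ws)) σ σa σb
    with shortCut-neighbours sc bw
  ... | inj₁ refl        = step (step (edge (Adj-sym G ws)) σa ab) σb bt
  ... | inj₂ (inj₁ refl) = ⊥-elim (Adj-irrefl G ws refl)
  ... | inj₂ (inj₂ refl) = edge (Adj-sym G ws)

  shortCut-answer-b : ShortCut a b → ∀ {σ} → σ a ≡ shorted → Free σ b → ShortWinsShortToMove σ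
  shortCut-answer-b sc@(_ , _ , _ , _ , ab , _) {σ} σa fb =
    smove b fb (shortWon⇒shortWinsCutToMove G s t (shortCut-shortWon sc _
      (trans (update-≢ σ shorted (Adj-irrefl G ab)) σa) (update-≡ σ b shorted)))

mainTheorem11 : ∀ {n} (G : SimpleGraph n) (s t : Fin n) → s ≢ t →
    Game.WeakLink G s t →
    ∀ (a b : Fin n) → Game.ShortCut G s t a b → degree G a > 2 →
    Game.Pivot G s t a
mainTheorem11 G s t _ (shortFirstWins , _) a b sc@(a≢s , a≢t , b≢s , b≢t , ab , _) _ =
  a≢s , a≢t , cmove (λ allSelected → ⊥-elim (allSelected b b≢s b≢t b-free)) cutReply
  where
  open Game G s t
  open PairStrategy G s t a b a≢s a≢t b≢s b≢t (Adj-irrefl G ab)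
                    (shortCut-neighbours G s t sc) (shortCut-not-bridge G s t sc)

  σ₀ : State _
  σ₀ = update initial a shorted

  b-free : σ₀ b ≡ free
  b-free = update-≢ initial shorted (≢-sym (Adj-irrefl G ab))

  cutReply : ∀ v → Free σ₀ v → ShortWinsShortToMove (update σ₀ v cut)
  cutReply v fv with v ≟ b
  ... | yes refl = imitateS imitates-initial shortFirstWins
  ... | no v≢b   = shortCut-answer-b G s t sc a-kept (b≢s , b≢t , trans (update-≢ σ₀ cut (≢-sym v≢b)) b-free)
    where
    a≢v : a ≢ v
    a≢v refl = different-marks (λ ()) (update-≡ initial a shorted) (proj₂ (proj₂ fv))
    a-kept : update σ₀ v cut a ≡ shorted
    a-kept = trans (update-≢ σ₀ cut a≢v) (update-≡ initial a shorted)
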